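{- Let $(P,\le,{}',0,1)$ be a Boolean poset and $a\in P$. Then: (i) if there exists some $b\in P$ such that for every $c\in\operatorname{Max}L(a,b)$ there exists some $d\in U(c)\setminus[a,1]$ such that the supremum $b\vee d$ exists and equals $1$, then $[a,1]$ is not the kernel of any congruence on $(P,\le,{}',0,1)$; (ii) if there exists some $b\in P$ such that for every $c\in\operatorname{Min}U(a',b)$ there exists some $d\in U(b)\setminus[a,1]$ such that the supremum $c\vee d$ exists and equals $1$, then $[a,1]$ is not the kernel of any congruence on $(P,\le,{}',0,1)$.
   Context: For a poset $(P,\le)$ and $A\subseteq P$ let $L(A)=\{x\mid x\le y\ \forall y\in A\}$, $U(A)=\{x\mid y\le x\ \forall y\in A\}$; write $L(x)$, $L(x,y)$, $L(A,z)=L(A\cup\{z\})$, $LU(A)=L(U(A))$, etc.; $\operatorname{Max}A$, $\operatorname{Min}A$ are the sets of maximal, minimal elements; $[a,1]=\{x\mid a\le x\le 1\}$; singletons are identified with their element. A poset is distributive if $L(U(x,y),z)=LU(L(x,z),L(y,z))$ for all $x,y,z$. A complementation on a bounded poset $(P,\le,0,1)$ is a unary operation $'$ with $U(x,x')=\{1\}$ and $L(x,x')=\{0\}$ for all $x$; a Boolean poset is a distributive bounded poset with a complementation. A binary relation $R$ is compatible with a map $Q\colon P^2\to2^P$ if whenever $(a_1,b_1),(a_2,b_2)\in R$ there exist $a\in Q(a_1,a_2)$, $b\in Q(b_1,b_2)$ with $(a,b)\in R$. A congruence on a Boolean poset is an equivalence relation $\Theta$ compatible with $(x,y)\mapsto\operatorname{Max}L(x,y)$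 and $(x,y)\mapsto\operatorname{Min}U(x,y)$ and with $'$ (i.e. $(a,b)\in\Theta$ implies $(a',b')\in\Theta$). The kernel of $\Theta$ is the class $[1]\Theta$. -}

module Defs where

open import Data.Product using (Σ; _×_; _,_; ∃)
open import Data.Sum using (_⊎_)
open import Data.Empty using (⊥)
open import Relation.Nullary using (¬_)
open import Relation.Binary.PropositionalEquality using (_≡_)

Pred : Set → Set₁
Pred A = A → Set

_⇔_ : Set → Set → Set
A ⇔ B = (A → B) × (B → A)

_≐_ : {A : Set} → Pred A → Pred A → Set
S ≐ T = ∀ x → S x ⇔ T x

module PosetNotions {P : Set} (_≤_ : P → P → Set) where

  L : Pred P → Pred P
  L A x = ∀ y → A y → x ≤ y

  U : Pred P → Pred P
  U A x = ∀ y → A y → y ≤ x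

  ｛_｝ : P → Pred P
  ｛ x ｝ y = y ≡ x

  pair : P → P → Pred P
  pair x y z = (z ≡ x) ⊎ (z ≡ y)

  _∪_ : Pred P → Pred P → Pred P
  (A ∪ B) z = A z ⊎ B z

  L+ : Pred P → P → Pred P
  L+ A z = L (A ∪ ｛ z ｝)

  Max : Pred P → Pred P
  Max A x = A x × (∀ y → A y → x ≤ y → y ≡ x)

  Min : Pred P → Pred P
  Min A x = A x × (∀ y → A y → y ≤ x → y ≡ x)

  IsSup : P → P → P → Set
  IsSup x y s = U (pair x y) s × (∀ t → U (pair x y) t → s ≤ t)

  Distributive : Set
  Distributive = ∀ x y z →
    L+ (U (pair x y)) z ≐ L (U (L (pair x z) ∪ L (pair y z)))

record BooleanPoset : Set₁ where
  field
    Carrier : Set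
    _≤_     : Carrier → Carrier → Set
    ≤-refl    : ∀ {x} → x ≤ x
    ≤-trans   : ∀ {x y z} → x ≤ y → y ≤ z → x ≤ z
    ≤-antisym : ∀ {x y} → x ≤ y → y ≤ x → x ≡ y
    𝟘 𝟙     : Carrier
    𝟘-least   : ∀ x → 𝟘 ≤ x
    𝟙-greatest : ∀ x → x ≤ 𝟙
    _′      : Carrier → Carrier
  open PosetNotions _≤_ public
  field
    distributive : Distributive
    compl-U : ∀ x → U (pair x (x ′)) ≐ ｛ 𝟙 ｝
    compl-L : ∀ x → L (pair x (x ′)) ≐ ｛ 𝟘 ｝

module _ (B : BooleanPoset) where
  open BooleanPoset B

  CompatibleWith : (Carrier → Carrier → Set) → (Carrier → Carrier → Pred Carrier) → Set
  CompatibleWith R Q = ∀ a₁ b₁ a₂ b₂ → R a₁ b₁ → R a₂ b₂ →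
    Σ Carrier λ a → Σ Carrier λ b → Q a₁ a₂ a × Q b₁ b₂ b × R a b

  record IsCongruence (Θ : Carrier → Carrier → Set) : Set where
    field
      refl′  : ∀ x → Θ x x
      sym′   : ∀ {x y} → Θ x y → Θ y x
      trans′ : ∀ {x y z} → Θ x y → Θ y z → Θ x z
      compat-meet : CompatibleWith Θ (λ x y → Max (L (pair x y)))
      compat-join : CompatibleWith Θ (λ x y → Min (U (pair x y)))
      compat-compl : ∀ {a b} → Θ a b → Θ (a ′) (b ′)

  Kernel : (Carrier → Carrier → Set) → Pred Carrier
  Kernel Θ x = Θ x 𝟙

  Up : Carrier → Pred Carrier
  Up a x = (a ≤ x) × (x ≤ 𝟙)

  IsKernelOfSomeCongruence : Pred Carrier → Set₁
  IsKernelOfSomeCongruence S =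
    Σ (Carrier → Carrier → Set) λ Θ → IsCongruence Θ × (Kernel Θ ≐ S)

{-# OPTIONS --safe #-}
-- If [a,1] were the kernel of Θ, then a Θ 1, and compatibility with meets (in (i)) or with
-- complementation and joins (in (ii)) produces c Θ b.  Joining both sides with the element d of
-- the hypothesis gives d Θ 1, because the two joins collapse to d and to 1; so d ∈ [a,1].
module Submission where

open import Defs
open import Data.Product using (Σ; _×_; _,_; proj₁; proj₂)
open import Data.Sum using (inj₁; inj₂)
open import Relation.Nullary using (¬_)
open import Relation.Binary.PropositionalEquality using (_≡_; refl; sym; subst)

module BooleanPosetProperties (B : BooleanPoset) where
  open BooleanPoset B

  U-pair-intro : ∀ {x y z} → x ≤ z → y ≤ z → U (pair x y) z
  U-pair-intro x≤z y≤z _ (inj₁ refl) = x≤z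
  U-pair-intro x≤z y≤z _ (inj₂ refl) = y≤z

  L-pair-intro : ∀ {x y z} → z ≤ x → z ≤ y → L (pair x y) z
  L-pair-intro z≤x z≤y _ (inj₁ refl) = z≤x
  L-pair-intro z≤x z≤y _ (inj₂ refl) = z≤y

  Min-U-pair-of-≤ : ∀ {x y z} → x ≤ y → Min (U (pair x y)) z → z ≡ y
  Min-U-pair-of-≤ x≤y (z∈U , minimal) =
    sym (minimal _ (U-pair-intro x≤y ≤-refl) (z∈U _ (inj₂ refl)))

  Max-L-pair-of-≥ : ∀ {x y z} → y ≤ x → Max (L (pair x y)) z → z ≡ y
  Max-L-pair-of-≥ y≤x (z∈L , maximal) =
    sym (maximal _ (L-pair-intro y≤x ≤-refl) (z∈L _ (inj₂ refl)))

  Min-U-pair-of-sup-𝟙 : ∀ {x y z} → IsSup x y 𝟙 → Min (U (pair x y)) z → z ≡ 𝟙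
  Min-U-pair-of-sup-𝟙 (_ , least) (z∈U , _) = ≤-antisym (𝟙-greatest _) (least _ z∈U)

  𝟙′≡𝟘 : 𝟙 ′ ≡ 𝟘
  𝟙′≡𝟘 = proj₁ (compl-L 𝟙 (𝟙 ′)) (L-pair-intro (𝟙-greatest _) ≤-refl)

  module CongruenceProperties {Θ : Carrier → Carrier → Set} (isCong : IsCongruence B Θ) where
    open IsCongruence isCong

    𝟙-congruent⇒Max-L-congruent : ∀ {a} → Θ a 𝟙 → ∀ b →
      Σ Carrier λ c → Max (L (pair a b)) c × Θ c b
    𝟙-congruent⇒Max-L-congruent aΘ𝟙 b =
      let c , e , c∈Max , e∈Max , cΘe = compat-meet _ _ _ _ aΘ𝟙 (refl′ b)
      in c , c∈Max , subst (Θ c) (Max-L-pair-of-≥ (𝟙-greatest b) e∈Max) cΘe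

    𝟘-congruent⇒Min-U-congruent : ∀ {a} → Θ a 𝟘 → ∀ b →
      Σ Carrier λ c → Min (U (pair a b)) c × Θ c b
    𝟘-congruent⇒Min-U-congruent aΘ𝟘 b =
      let c , e , c∈Min , e∈Min , cΘe = compat-join _ _ _ _ aΘ𝟘 (refl′ b)
      in c , c∈Min , subst (Θ c) (Min-U-pair-of-≤ (𝟘-least b) e∈Min) cΘe

    ′-𝟙-congruent : ∀ {a} → Θ a 𝟙 → Θ (a ′) 𝟘
    ′-𝟙-congruent aΘ𝟙 = subst (Θ _) 𝟙′≡𝟘 (compat-compl aΘ𝟙)

    ≤-sup-𝟙⇒𝟙-congruent : ∀ {x y d} → Θ x y → x ≤ d → IsSup y d 𝟙 → Θ d 𝟙
    ≤-sup-𝟙⇒𝟙-congruent xΘy x≤d y∨d≡𝟙 =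
      let u , v , u∈Min , v∈Min , uΘv = compat-join _ _ _ _ xΘy (refl′ _)
      in subst (λ t → Θ t 𝟙) (Min-U-pair-of-≤ x≤d u∈Min)
           (subst (Θ u) (Min-U-pair-of-sup-𝟙 y∨d≡𝟙 v∈Min) uΘv)

    module _ {a : Carrier} (ker : Kernel B Θ ≐ Up B a) where

      a-𝟙-congruent : Θ a 𝟙
      a-𝟙-congruent = proj₂ (ker a) (≤-refl , 𝟙-greatest a)

      Up-kernel⇒¬meet-criterion :
        ¬ (Σ Carrier λ b → ∀ c → Max (L (pair a b)) c →
             Σ Carrier λ d → U ｛ c ｝ d × ¬ Up B a d × IsSup b d 𝟙)
      Up-kernel⇒¬meet-criterion (b , criterion) =
        let c , c∈Max , cΘb = 𝟙-congruent⇒Max-L-congruent a-𝟙-congruent b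
            d , c≤d , d∉Up , b∨d≡𝟙 = criterion c c∈Max
        in d∉Up (proj₁ (ker d) (≤-sup-𝟙⇒𝟙-congruent cΘb (c≤d c refl) b∨d≡𝟙))

      Up-kernel⇒¬join-criterion :
        ¬ (Σ Carrier λ b → ∀ c → Min (U (pair (a ′) b)) c →
             Σ Carrier λ d → U ｛ b ｝ d × ¬ Up B a d × IsSup c d 𝟙)
      Up-kernel⇒¬join-criterion (b , criterion) =
        let c , c∈Min , cΘb = 𝟘-congruent⇒Min-U-congruent (′-𝟙-congruent a-𝟙-congruent) b
            d , b≤d , d∉Up , c∨d≡𝟙 = criterion c c∈Min
        in d∉Up (proj₁ (ker d) (≤-sup-𝟙⇒𝟙-congruent (sym′ cΘb) (b≤d b refl) c∨d≡𝟙))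

lemma5p4 : (B : BooleanPoset) (a : BooleanPoset.Carrier B) →
    let open BooleanPoset B in
    ((Σ Carrier λ b → ∀ c → Max (L (pair a b)) c →
        Σ Carrier λ d → U ｛ c ｝ d × ¬ Up B a d × IsSup b d 𝟙)
      → ¬ IsKernelOfSomeCongruence B (Up B a))
    ×
    ((Σ Carrier λ b → ∀ c → Min (U (pair (a ′) b)) c →
        Σ Carrier λ d → U ｛ b ｝ d × ¬ Up B a d × IsSup c d 𝟙)
      → ¬ IsKernelOfSomeCongruence B (Up B a))
lemma5p4 B a =
    (λ criterion (_ , isCong , ker) → Up-kernel⇒¬meet-criterion isCong ker criterion)
  , (λ criterion (_ , isCong , ker) → Up-kernel⇒¬join-criterion isCong ker criterion)
  where open BooleanPosetProperties.CongruenceProperties B
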